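{- Let $n\in\mathbb{N}$, let $\alpha>0$ be a real number and let $\lambda\in(0,1)$. Let $X_1,\dots,X_n$ be independent Bernoulli random variables with $P\{X_j=1\}=\frac{1}{j}$ and $P\{X_j=0\}=1-\frac{1}{j}$ for $j=1,\dots,n$, and put $Y_n=X_1+\cdots+X_n$. Let $X_{1,\lambda}(\alpha),\dots,X_{n,\lambda}(\alpha)$ be independent Bernoulli random variables with $P\{X_{j,\lambda}(\alpha)=1\}=\frac{\alpha}{\alpha+\lambda j}$ and $P\{X_{j,\lambda}(\alpha)=0\}=1-\frac{\alpha}{\alpha+\lambda j}$ for $j=1,\dots,n$, and put $Z_{n,\lambda}(\alpha)=X_{1,\lambda}(\alpha)+\cdots+X_{n,\lambda}(\alpha)$. Then for every (complex) number $z$, $$E\Big[\Big(1+\frac{\alpha}{\lambda}\Big)^{Y_n}\Big]\,E\Big[z^{Z_{n,\lambda}(\alpha)}\Big]=E\Big[\Big(1+\frac{\alpha z}{\lambda}\Big)^{Y_n}\Big].$$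
   Context: Here $E$ denotes expectation; $Y_n$ and $Z_{n,\lambda}(\alpha)$ take integer values in $\{0,1,\dots,n\}$, so all expectations are finite sums. -}

module Defs where

open import Level using (Level)
open import Algebra.Bundles using (CommutativeRing)
open import Data.Nat using (ℕ; zero; suc; _≤_)
open import Data.Bool using (Bool; true; false)
open import Data.Vec using (Vec; []; _∷_)
open import Data.List using (List; []; _∷_; map; _++_)

-- All 0/1 outcome vectors of length n (true = value 1, false = value 0).
outcomes : (n : ℕ) → List (Vec Bool n)
outcomes zero    = [] ∷ []
outcomes (suc n) = map (false ∷_) (outcomes n) ++ map (true ∷_) (outcomes n)

count : {n : ℕ} → Vec Bool n → ℕ
count []          = 0
count (false ∷ x) = count x
count (true ∷ x)  = suc (count x)

module _ {c ℓ : Level} (R : CommutativeRing c ℓ) where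
  open CommutativeRing R

  ι : ℕ → Carrier
  ι zero    = 0#
  ι (suc k) = 1# + ι k

  pow : Carrier → ℕ → Carrier
  pow w zero    = 1#
  pow w (suc k) = w * pow w k

  sumR : List Carrier → Carrier
  sumR []       = 0#
  sumR (a ∷ as) = a + sumR as

  -- Probability of the outcome x_j ... x_n of independent Bernoulli variables
  -- X_j, ..., X_n with P{X_i = 1} = p i (the first coordinate is index j).
  weightFrom : (p : ℕ → Carrier) → (j : ℕ) → {m : ℕ} → Vec Bool m → Carrier
  weightFrom p j []          = 1#
  weightFrom p j (true ∷ x)  = p j * weightFrom p (suc j) x
  weightFrom p j (false ∷ x) = (1# - p j) * weightFrom p (suc j) x

  -- E[ w ^ (X_1 + ... + X_n) ] for independent Bernoulli X_j with
  -- P{X_j = 1} = p j, computed as a sum over all 2^n outcomes.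
  expectPow : (n : ℕ) → (p : ℕ → Carrier) → Carrier → Carrier
  expectPow n p w = sumR (map (λ x → weightFrom p 1 x * pow w (count x)) (outcomes n))

{-# OPTIONS --safe #-}
-- The generating function of a sum of independent Bernoulli variables factorises:
-- E[w^(X_1 + ⋯ + X_n)] = ∏_j (1 − p_j + p_j w). Both sides thus become products over
-- j = 1..n, and they agree factor by factor: writing q_j = α/(α + λj),
--   (1 + α/(λj)) · (1 − q_j + q_j z) = ((λj + α)/(λj)) · ((λj + αz)/(α + λj)) = 1 + αz/(λj).
module Submission where

open import Defs
open import Level using (Level)
open import Algebra.Bundles using (CommutativeRing)
open import Data.Nat using (ℕ; zero; suc; _≤_; _<_; z≤n; s≤s; s≤s⁻¹) renaming (_+_ to _+ℕ_)
open import Data.Nat.Properties using (≤-refl; <⇒≤; m<m+n; +-suc)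
open import Data.Bool using (Bool; true; false)
open import Data.Vec using (Vec; _∷_)
open import Data.List using (List; []; _∷_; map; _++_)
open import Data.List.Properties using (map-++; map-∘)
open import Function using (_∘_)
import Relation.Binary.PropositionalEquality as ≡
import Algebra.Properties.Ring as RingProperties
import Algebra.Solver.Ring.NaturalCoefficients.Default as SemiringSolver
import Relation.Binary.Reasoning.Setoid as SetoidReasoning

module _ {c ℓ : Level} (R : CommutativeRing c ℓ) where
  open CommutativeRing R
  open RingProperties ring using (x[y-z]≈xy-xz)
  open SemiringSolver commutativeSemiring using (solve; _:=_; _:+_; _:*_; con)
  open SetoidReasoning setoid

  sumR-++ : (xs ys : List Carrier) → sumR R (xs ++ ys) ≈ sumR R xs + sumR R ys
  sumR-++ []       ys = sym (+-identityˡ _)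
  sumR-++ (x ∷ xs) ys = trans (+-congˡ (sumR-++ xs ys)) (sym (+-assoc _ _ _))

  sumR-*ˡ : {A : Set} (k : Carrier) (f g : A → Carrier) (xs : List A) →
            (∀ x → f x ≈ k * g x) → sumR R (map f xs) ≈ k * sumR R (map g xs)
  sumR-*ˡ k f g []       f≈kg = sym (zeroʳ k)
  sumR-*ˡ k f g (x ∷ xs) f≈kg =
    trans (+-cong (f≈kg x) (sumR-*ˡ k f g xs f≈kg)) (sym (distribˡ k _ _))

  sumR-outcomes-suc : {m : ℕ} (f : Vec Bool (suc m) → Carrier) →
    sumR R (map f (outcomes (suc m)))
      ≈ sumR R (map (f ∘ (false ∷_)) (outcomes m)) + sumR R (map (f ∘ (true ∷_)) (outcomes m))
  sumR-outcomes-suc {m} f = begin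
    sumR R (map f (map (false ∷_) os ++ map (true ∷_) os))
      ≡⟨ ≡.cong (sumR R) (map-++ f (map (false ∷_) os) (map (true ∷_) os)) ⟩
    sumR R (map f (map (false ∷_) os) ++ map f (map (true ∷_) os))
      ≈⟨ sumR-++ (map f (map (false ∷_) os)) (map f (map (true ∷_) os)) ⟩
    sumR R (map f (map (false ∷_) os)) + sumR R (map f (map (true ∷_) os))
      ≡⟨ ≡.cong₂ (λ u v → sumR R u + sumR R v) (≡.sym (map-∘ os)) (≡.sym (map-∘ os)) ⟩
    sumR R (map (f ∘ (false ∷_)) os) + sumR R (map (f ∘ (true ∷_)) os) ∎
    where os = outcomes m

  productFrom : (ℕ → Carrier) → ℕ → ℕ → Carrier
  productFrom f j zero    = 1#
  productFrom f j (suc m) = f j * productFrom f (suc j) m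

  productFrom-* : (f g h : ℕ → Carrier) (j m : ℕ) →
    (∀ i → j ≤ i → i < j +ℕ m → f i * g i ≈ h i) →
    productFrom f j m * productFrom g j m ≈ productFrom h j m
  productFrom-* f g h j zero    fg≈h = *-identityˡ 1#
  productFrom-* f g h j (suc m) fg≈h = begin
    (f j * productFrom f (suc j) m) * (g j * productFrom g (suc j) m)
      ≈⟨ solve 4 (λ a b c d → (a :* b) :* (c :* d) := (a :* c) :* (b :* d)) refl _ _ _ _ ⟩
    (f j * g j) * (productFrom f (suc j) m * productFrom g (suc j) m)
      ≈⟨ *-cong (fg≈h j ≤-refl (m<m+n j (s≤s z≤n))) (productFrom-* f g h (suc j) m fg≈h′) ⟩
    h j * productFrom h (suc j) m ∎
    where
    fg≈h′ : ∀ i → suc j ≤ i → i < suc j +ℕ m → f i * g i ≈ h i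
    fg≈h′ i j<i i<1+j+m = fg≈h i (<⇒≤ j<i) (≡.subst (i <_) (≡.sym (+-suc j m)) i<1+j+m)

  bernoulliPgf : Carrier → Carrier → Carrier
  bernoulliPgf q w = 1# - q + q * w

  sumR-outcomes≈productFrom : (p : ℕ → Carrier) (w : Carrier) (j m : ℕ) →
    sumR R (map (λ x → weightFrom R p j x * pow R w (count x)) (outcomes m))
      ≈ productFrom (λ i → bernoulliPgf (p i) w) j m
  sumR-outcomes≈productFrom p w j zero    = trans (+-identityʳ _) (*-identityˡ 1#)
  sumR-outcomes≈productFrom p w j (suc m) = begin
    sumR R (map (term j) (outcomes (suc m)))
      ≈⟨ sumR-outcomes-suc {m} (term j) ⟩
    sumR R (map (term j ∘ (false ∷_)) os) + sumR R (map (term j ∘ (true ∷_)) os)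
      ≈⟨ +-cong (sumR-*ˡ _ _ (term (suc j)) os (λ x → *-assoc _ _ _))
                (sumR-*ˡ _ _ (term (suc j)) os term-true) ⟩
    (1# - p j) * sumR R (map (term (suc j)) os) + (p j * w) * sumR R (map (term (suc j)) os)
      ≈⟨ sym (distribʳ _ _ _) ⟩
    bernoulliPgf (p j) w * sumR R (map (term (suc j)) os)
      ≈⟨ *-congˡ (sumR-outcomes≈productFrom p w (suc j) m) ⟩
    productFrom (λ i → bernoulliPgf (p i) w) j (suc m) ∎
    where
    os = outcomes m
    term : ℕ → {k : ℕ} → Vec Bool k → Carrier
    term i x = weightFrom R p i x * pow R w (count x)
    term-true : (x : Vec Bool m) → term j (true ∷ x) ≈ (p j * w) * term (suc j) x
    term-true x = solve 4 (λ a b c d → (a :* b) :* (c :* d) := (a :* c) :* (b :* d)) refl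
                    (p j) (weightFrom R p (suc j) x) w (pow R w (count x))

  expectPow≈productFrom : (n : ℕ) (p : ℕ → Carrier) (w : Carrier) →
    expectPow R n p w ≈ productFrom (λ i → bernoulliPgf (p i) w) 1 n
  expectPow≈productFrom n p w = sumR-outcomes≈productFrom p w 1 n

  bernoulliPgf-1+ : (q u : Carrier) → bernoulliPgf q (1# + u) ≈ 1# + q * u
  bernoulliPgf-1+ q u = begin
    1# - q + q * (1# + u)
      ≈⟨ solve 3 (λ q q⁻ u → (con 1 :+ q⁻) :+ q :* (con 1 :+ u) := (con 1 :+ (q⁻ :+ q)) :+ q :* u)
               refl q (- q) u ⟩
    (1# + (- q + q)) + q * u
      ≈⟨ +-congʳ (trans (+-congˡ (-‿inverseˡ q)) (+-identityʳ 1#)) ⟩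
    1# + q * u ∎

  bernoulliPgf-compose : {a J L λ′ α e : Carrier} (z : Carrier) →
    J * a ≈ 1# → λ′ * L ≈ 1# → (α + λ′ * J) * e ≈ 1# →
    bernoulliPgf a (1# + α * L) * bernoulliPgf (α * e) z ≈ bernoulliPgf a (1# + α * z * L)
  bernoulliPgf-compose {a} {J} {L} {λ′} {α} {e} z Ja≈1 λ′L≈1 [α+λ′J]e≈1 = begin
    bernoulliPgf a (1# + α * L) * bernoulliPgf (α * e) z
      ≈⟨ *-congʳ (trans (bernoulliPgf-1+ a (α * L)) (+-congˡ aαL≈αt)) ⟩
    s * (1# - α * e + α * e * z)
      ≈⟨ solve 5 (λ s αe⁻ α e z → s :* ((con 1 :+ αe⁻) :+ α :* e :* z)
                                   := s :* (con 1 :+ αe⁻) :+ α :* (s :* e) :* z)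
               refl s (- (α * e)) α e z ⟩
    s * (1# - α * e) + α * (s * e) * z
      ≈⟨ +-cong s[1-αe]≈1 (*-congʳ (*-congˡ se≈t)) ⟩
    1# + α * t * z
      ≈⟨ +-congˡ (solve 4 (λ a L α z → α :* (a :* L) :* z := a :* (α :* z :* L)) refl a L α z) ⟩
    1# + a * (α * z * L)
      ≈⟨ sym (bernoulliPgf-1+ a (α * z * L)) ⟩
    bernoulliPgf a (1# + α * z * L) ∎
    where
    t s : Carrier
    t = a * L
    s = 1# + α * t
    aαL≈αt : a * (α * L) ≈ α * t
    aαL≈αt = solve 3 (λ a L α → a :* (α :* L) := α :* (a :* L)) refl a L α
    se≈t : s * e ≈ t
    se≈t = begin
      (1# + α * t) * e
        ≈⟨ *-congʳ (+-congʳ (sym (trans (*-cong Ja≈1 λ′L≈1) (*-identityˡ 1#)))) ⟩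
      ((J * a) * (λ′ * L) + α * t) * e
        ≈⟨ solve 6 (λ J a λ′ L α e → ((J :* a) :* (λ′ :* L) :+ α :* (a :* L)) :* e
                                     := (a :* L) :* ((α :+ λ′ :* J) :* e))
                 refl J a λ′ L α e ⟩
      t * ((α + λ′ * J) * e)
        ≈⟨ trans (*-congˡ [α+λ′J]e≈1) (*-identityʳ t) ⟩
      t ∎
    s[1-αe]≈1 : s * (1# - α * e) ≈ 1#
    s[1-αe]≈1 = begin
      s * (1# - α * e)
        ≈⟨ x[y-z]≈xy-xz s 1# (α * e) ⟩
      s * 1# - s * (α * e)
        ≈⟨ +-cong (*-identityʳ s) (-‿cong (trans (solve 3 (λ s α e → s :* (α :* e) := α :* (s :* e)) refl s α e)
                                                   (*-congˡ se≈t))) ⟩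
      (1# + α * t) - α * t
        ≈⟨ trans (+-assoc 1# _ _) (trans (+-congˡ (-‿inverseʳ (α * t))) (+-identityʳ 1#)) ⟩
      1# ∎

theorem2 : {c ℓ : Level} (R : CommutativeRing c ℓ) →
    let open CommutativeRing R in
    (n : ℕ) (α λ′ z λ⁻¹ : Carrier) (inv d : ℕ → Carrier) →
    λ′ * λ⁻¹ ≈ 1# →
    ((j : ℕ) → 1 ≤ j → j ≤ n → ι R j * inv j ≈ 1#) →
    ((j : ℕ) → 1 ≤ j → j ≤ n → (α + λ′ * ι R j) * d j ≈ 1#) →
    expectPow R n inv (1# + α * λ⁻¹) * expectPow R n (λ j → α * d j) z
      ≈ expectPow R n inv (1# + α * z * λ⁻¹)
theorem2 R n α λ′ z λ⁻¹ inv d λ′λ⁻¹≈1 j·inv≈1 [α+λ′j]d≈1 = begin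
  expectPow R n inv (1# + α * λ⁻¹) * expectPow R n (λ j → α * d j) z
    ≈⟨ *-cong (expectPow≈productFrom R n inv _) (expectPow≈productFrom R n (λ j → α * d j) z) ⟩
  productFrom R (λ j → bernoulliPgf R (inv j) (1# + α * λ⁻¹)) 1 n
    * productFrom R (λ j → bernoulliPgf R (α * d j) z) 1 n
    ≈⟨ productFrom-* R _ _ _ 1 n (λ j 1≤j j<1+n →
         bernoulliPgf-compose R z (j·inv≈1 j 1≤j (s≤s⁻¹ j<1+n)) λ′λ⁻¹≈1 ([α+λ′j]d≈1 j 1≤j (s≤s⁻¹ j<1+n))) ⟩
  productFrom R (λ j → bernoulliPgf R (inv j) (1# + α * z * λ⁻¹)) 1 n
    ≈⟨ sym (expectPow≈productFrom R n inv _) ⟩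
  expectPow R n inv (1# + α * z * λ⁻¹) ∎
  where
  open CommutativeRing R
  open SetoidReasoning setoid
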